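{- For any CTL formula $\Phi$ one can build an equivalent QCTL formula $\Psi$ of the form \[\exists\kappa_1\ldots\exists\kappa_m.\Big(\Phi_0\wedge\bigwedge_{1\le i\le m}\mathsf{AG}(\kappa_i\leftrightarrow\theta_i)\Big)\] where $\Phi_0$ is a Boolean combination of basic CTL formulas, each $\theta_i$ ($1\le i\le m$) is a basic CTL formula, and $|\Psi|$ is in $O(|\Phi|)$.
   Context: QCTL formulas: $\varphi::= q\mid\neg\varphi\mid\varphi\vee\varphi\mid \mathsf{EX}\varphi\mid \mathsf{E}\varphi\mathsf{U}\varphi\mid\mathsf{A}\varphi\mathsf{U}\varphi\mid\exists p.\varphi$; CTL formulas are the QCTL formulas without propositional quantifiers. They are interpreted at states of finite Kripke structures (every vertex has a successor) with the usual CTL semantics and structure semantics for quantifiers ($\exists p.\varphi$ holds iff some relabelling of $p$ on the same graph, keeping other propositions, makes $\varphi$ true). $\mathsf{AG}\varphi=\neg\mathsf{E}\top\mathsf{U}\neg\varphi$. Equivalence: same truth value at every state of every Kripke structure. A CTL formula is basic if it is of the form $\mathsf{EX}\alpha$, $\mathsf{E}\alpha\mathsf{U}\beta$ or $\mathsf{A}\alpha\mathsf{U}\beta$ with $\alpha,\beta$ Boolean combinations of atomic propositions. Size: $|q|=1$; $|\neg\varphi|=|\exists p.\varphi|=|\mathsf{EX}\varphi|=1+|\varphi|$; $|\varphi\vee\psi|=|\mathsf{E}\varphi\mathsf{U}\psi|=|\mathsf{A}\varphi\mathsf{U}\psi|=1+|\varphi|+|\psi|$, with abbreviations expanded into primitives.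 -}

module Defs where

open import Data.Nat using (ℕ; zero; suc; _+_; _<_; _≟_)
open import Data.Fin using (Fin)
open import Data.Bool using (Bool; true; false)
open import Data.Product using (Σ; ∃; ∃-syntax; _×_; _,_; proj₂)
open import Data.Sum using (_⊎_)
open import Data.List using (List; []; _∷_)
open import Relation.Nullary using (¬_; yes; no)
open import Relation.Binary.PropositionalEquality using (_≡_)

Prop : Set
Prop = ℕ

data Form : Set where
  atom : Prop → Form
  neg  : Form → Form
  _∨′_ : Form → Form → Form
  EX   : Form → Form
  EU   : Form → Form → Form
  AU   : Form → Form → Form
  ∃p   : Prop → Form → Form

size : Form → ℕ
size (atom q)  = 1
size (neg φ)   = suc (size φ)
size (φ ∨′ ψ)  = suc (size φ + size ψ)
size (EX φ)    = suc (size φ)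
size (EU φ ψ)  = suc (size φ + size ψ)
size (AU φ ψ)  = suc (size φ + size ψ)
size (∃p p φ)  = suc (size φ)

⊤′ : Form
⊤′ = atom 0 ∨′ neg (atom 0)

_∧′_ : Form → Form → Form
φ ∧′ ψ = neg (neg φ ∨′ neg ψ)

_⇒′_ : Form → Form → Form
φ ⇒′ ψ = neg φ ∨′ ψ

_⇔′_ : Form → Form → Form
φ ⇔′ ψ = (φ ⇒′ ψ) ∧′ (ψ ⇒′ φ)

AG : Form → Form
AG φ = neg (EU ⊤′ (neg φ))

data IsCTL : Form → Set where
  atom : ∀ q → IsCTL (atom q)
  neg  : ∀ {φ} → IsCTL φ → IsCTL (neg φ)
  or   : ∀ {φ ψ} → IsCTL φ → IsCTL ψ → IsCTL (φ ∨′ ψ)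
  EX   : ∀ {φ} → IsCTL φ → IsCTL (EX φ)
  EU   : ∀ {φ ψ} → IsCTL φ → IsCTL ψ → IsCTL (EU φ ψ)
  AU   : ∀ {φ ψ} → IsCTL φ → IsCTL ψ → IsCTL (AU φ ψ)

data IsPropositional : Form → Set where
  atom : ∀ q → IsPropositional (atom q)
  neg  : ∀ {φ} → IsPropositional φ → IsPropositional (neg φ)
  or   : ∀ {φ ψ} → IsPropositional φ → IsPropositional ψ → IsPropositional (φ ∨′ ψ)

data IsBasic : Form → Set where
  EX : ∀ {α} → IsPropositional α → IsBasic (EX α)
  EU : ∀ {α β} → IsPropositional α → IsPropositional β → IsBasic (EU α β)
  AU : ∀ {α β} → IsPropositional α → IsPropositional β → IsBasic (AU α β)

data IsBoolCombBasic : Form → Set where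
  basic : ∀ {φ} → IsBasic φ → IsBoolCombBasic φ
  neg   : ∀ {φ} → IsBoolCombBasic φ → IsBoolCombBasic (neg φ)
  or    : ∀ {φ ψ} → IsBoolCombBasic φ → IsBoolCombBasic ψ → IsBoolCombBasic (φ ∨′ ψ)

record Kripke : Set where
  field
    n     : ℕ
    R     : Fin n → Fin n → Bool
    lab   : Prop → Fin n → Bool
    total : ∀ s → ∃[ t ] (R s t ≡ true)
open Kripke public

relabel : (K : Kripke) → Prop → (Fin (n K) → Bool) → Kripke
relabel K p f = record
  { n = n K ; R = R K ; total = total K
  ; lab = λ q s → lab′ q s }
  where
  lab′ : Prop → Fin (n K) → Bool
  lab′ q s with q ≟ p
  ... | yes _ = f s
  ... | no  _ = lab K q s

Path : (K : Kripke) → Fin (n K) → Set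
Path K s = Σ (ℕ → Fin (n K)) λ π → (π 0 ≡ s) × (∀ i → R K (π i) (π (suc i)) ≡ true)

_,_⊨_ : (K : Kripke) → Fin (n K) → Form → Set
K , s ⊨ atom q   = lab K q s ≡ true
K , s ⊨ neg φ    = ¬ (K , s ⊨ φ)
K , s ⊨ (φ ∨′ ψ) = (K , s ⊨ φ) ⊎ (K , s ⊨ ψ)
K , s ⊨ EX φ     = ∃[ t ] (R K s t ≡ true × (K , t ⊨ φ))
K , s ⊨ EU φ ψ   = Σ (Path K s) λ π → ∃[ k ]
                     ((K , Data.Product.proj₁ π k ⊨ ψ) × (∀ j → j < k → K , Data.Product.proj₁ π j ⊨ φ))
K , s ⊨ AU φ ψ   = (π : Path K s) → ∃[ k ]
                     ((K , Data.Product.proj₁ π k ⊨ ψ) × (∀ j → j < k → K , Data.Product.proj₁ π j ⊨ φ))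
K , s ⊨ ∃p p φ   = Σ (Fin (n K) → Bool) λ f → relabel K p f , s ⊨ φ

_≣_ : Form → Form → Set
φ ≣ ψ = (K : Kripke) (s : Fin (n K)) → ((K , s ⊨ φ) → (K , s ⊨ ψ)) × ((K , s ⊨ ψ) → (K , s ⊨ φ))

conjDefs : Form → List (Prop × Form) → Form
conjDefs Φ₀ []             = Φ₀
conjDefs Φ₀ ((κ , θ) ∷ ks) = conjDefs Φ₀ ks ∧′ AG (atom κ ⇔′ θ)

quantify : List (Prop × Form) → Form → Form
quantify []             φ = φ
quantify ((κ , _) ∷ ks) φ = ∃p κ (quantify ks φ)

normalForm : Form → List (Prop × Form) → Form
normalForm Φ₀ ks = quantify ks (conjDefs Φ₀ ks)

-- Each temporal subformula ψ of Φ gets a fresh atom κ with the definition AG (κ ↔ θ), where the basic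
-- formula θ is ψ with its immediate temporal subformulas replaced by their atoms; replacing the maximal
-- temporal subformulas of Φ in the same way leaves a propositional skeleton, made basic as E ⊥ U skeleton.
-- On the states reachable from the current one, the definitions force, bottom-up, every κ to hold exactly
-- where its ψ does, and then the skeleton agrees with Φ. Conversely, labelling each κ by the truth value
-- of its ψ satisfies all the definitions; such labellings exist because CTL model checking is decidable
-- on finite structures: EU and AU are least fixed points of monotone operators on sets of states, reached
-- after at most one step more than there are states. Each definition costs a constant plus twice the size
-- of its θ, and these θ's together are linear in Φ, whence |Ψ| ≤ 32 |Φ|.
module Submission where

open import Defs
open import Data.Bool using (Bool; true; false)
import Data.Bool as Bool
open import Data.Empty using (⊥-elim)
open import Data.Fin using (Fin)
open import Data.Fin.Properties using (any?; all?)
open import Data.Fin.Subset as Subset using (Subset; _∈_; _∉_; _⊆_; ∣_∣)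
open import Data.Fin.Subset.Properties using (_∈?_; _⊂?_; ⊆-antisym; p⊂q⇒∣p∣<∣q∣; ∣p∣≤n; ∉⊥)
open import Data.List using (List; []; _∷_; _++_; _∷ʳ_; [_]; map; length)
open import Data.List.Extrema.Nat using (max; xs≤max)
open import Data.List.Properties using (map-++; map-∘)
open import Data.List.Relation.Unary.All using (All; []; _∷_)
import Data.List.Relation.Unary.All as All
open import Data.List.Relation.Unary.All.Properties using (++⁺; ++⁻; ∷ʳ⁺; ∷ʳ⁻; map⁺; map⁻)
open import Data.List.Relation.Unary.AllPairs using (AllPairs; []; _∷_)
import Data.List.Relation.Unary.AllPairs.Properties as AllPairs
open import Data.List.Relation.Unary.Any using (Any; here; there)
import Data.List.Relation.Unary.Any as Any
open import Data.Nat using (ℕ; zero; suc; _+_; _*_; _≤_; _<_; z≤n; s≤s; _≟_)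
open import Data.Nat.GeneralisedArithmetic using (fold)
open import Data.Nat.ListAction using (sum)
open import Data.Nat.ListAction.Properties using (sum-++)
open import Data.Nat.Properties
  using ( ≤-refl; ≤-reflexive; ≤-trans; ≤-<-trans; <-≤-trans; <⇒≤; <⇒≢; <⇒≱; 1+n≰n; n<1+n
        ; m≤n⇒m≤1+n; m<n⇒m<1+n; m≤m+n; +-comm; +-monoʳ-≤; +-monoˡ-≤; +-mono-≤; *-monoʳ-≤
        ; *-suc; *-distribˡ-+; *-distribʳ-+; module ≤-Reasoning )
open import Data.Nat.Tactic.RingSolver using (solve-∀)
open import Data.Product using (Σ; ∃-syntax; _×_; _,_; proj₁; proj₂)
open import Data.Sum using (_⊎_; inj₁; inj₂; [_,_]′)
open import Data.Sum.Function.Propositional using (_⊎-⇔_)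
open import Data.Vec using (tabulate)
open import Data.Vec.Properties using (lookup∘tabulate; []=⇒lookup; lookup⇒[]=)
open import Function using (_∘_; _on_; _⇔_; mk⇔; Equivalence)
open import Function.Properties.Equivalence using () renaming (sym to ⇔-sym; trans to ⇔-trans)
open import Function.Related.TypeIsomorphisms using (¬-cong-⇔)
open import Level using (0ℓ)
open import Relation.Binary.Construct.Closure.ReflexiveTransitive using (Star; ε; _◅_; _◅◅_)
open import Relation.Binary.PropositionalEquality
  using (_≡_; _≢_; refl; sym; trans; cong; subst; module ≡-Reasoning)
open import Relation.Nullary
  using (Dec; yes; no; does; ¬_; ¬?; _×-dec_; _⊎-dec_; _→-dec_; contradiction)
open import Relation.Nullary.Decidable using (map′; dec-true; decidable-stable; toSum)
open import Relation.Unary using (Pred; Decidable)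

open Equivalence using (to; from)

State : Kripke → Set
State K = Fin (n K)

Edge : (K : Kripke) → State K → State K → Set
Edge K s t = R K s t ≡ true

Reach : (K : Kripke) → State K → State K → Set
Reach K = Star (Edge K)

Until : {S : Set} → Pred S 0ℓ → Pred S 0ℓ → (ℕ → S) → Set
Until A B π = ∃[ k ] (B (π k) × (∀ j → j < k → A (π j)))

module _ (K : Kripke) where

  EXₚ AXₚ : Pred (State K) 0ℓ → Pred (State K) 0ℓ
  EXₚ A s = ∃[ t ] (Edge K s t × A t)
  AXₚ A s = ∀ t → Edge K s t → A t

  EUₚ AUₚ : Pred (State K) 0ℓ → Pred (State K) 0ℓ → Pred (State K) 0ℓ
  EUₚ A B s = Σ (Path K s) (Until A B ∘ proj₁)
  AUₚ A B s = (π : Path K s) → Until A B (proj₁ π)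

  EX? : ∀ {A} → Decidable A → Decidable (EXₚ A)
  EX? A? s = any? λ t → (R K s t Bool.≟ true) ×-dec A? t

  AX? : ∀ {A} → Decidable A → Decidable (AXₚ A)
  AX? A? s = all? λ t → (R K s t Bool.≟ true) →-dec A? t

  iteratePath : (next : State K → State K) → (∀ t → Edge K t (next t)) → ∀ s → Path K s
  iteratePath next edge s = fold s next , refl , λ i → edge (fold s next i)

  somePath : ∀ s → Path K s
  somePath = iteratePath (proj₁ ∘ total K) (proj₂ ∘ total K)

  _◅ₚ_ : ∀ {s t} → Edge K s t → Path K t → Path K s
  _◅ₚ_ {s} e (π , π₀ , edges) = π′ , refl , edges′
    where
    π′ : ℕ → State K
    π′ zero = s
    π′ (suc i) = π i
    edges′ : ∀ i → Edge K (π′ i) (π′ (suc i))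
    edges′ zero = subst (Edge K s) (sym π₀) e
    edges′ (suc i) = edges i

  tailₚ : ∀ {s} (π : Path K s) → Path K (proj₁ π 1)
  tailₚ (π , _ , edges) = π ∘ suc , refl , edges ∘ suc

  path⇒reach : ∀ {s} (π : Path K s) i → Reach K s (proj₁ π i)
  path⇒reach (π , refl , edges) zero = ε
  path⇒reach (π , refl , edges) (suc i) = path⇒reach (π , refl , edges) i ◅◅ (edges i ◅ ε)

  reach⇒path : ∀ {s t} → Reach K s t → Σ (Path K s) λ π → ∃[ k ] proj₁ π k ≡ t
  reach⇒path {s} ε = somePath s , 0 , refl
  reach⇒path (e ◅ r) with reach⇒path r
  ... | π , k , πk≡t = e ◅ₚ π , suc k , πk≡t

-- Model checking

toSubset : ∀ {m} {P : Pred (Fin m) 0ℓ} → Decidable P → Subset m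
toSubset P? = tabulate (does ∘ P?)

∈-toSubset : ∀ {m} {P : Pred (Fin m) 0ℓ} (P? : Decidable P) {x} → x ∈ toSubset P? ⇔ P x
∈-toSubset P? {x} =
  mk⇔ member (λ px → lookup⇒[]= x _ (trans (lookup∘tabulate (does ∘ P?) x) (dec-true (P? x) px)))
  where
  member : x ∈ toSubset P? → _
  member x∈ with P? x | trans (sym (lookup∘tabulate (does ∘ P?) x)) ([]=⇒lookup x∈)
  ... | yes px | _ = px
  ... | no _ | ()

module LeastFixedPoint {m : ℕ} (F : Subset m → Subset m) (F-mono : ∀ {p q} → p ⊆ q → F p ⊆ F q) where

  approx : ℕ → Subset m
  approx = fold Subset.⊥ F

  approx-⊆-suc : ∀ k → approx k ⊆ approx (suc k)
  approx-⊆-suc zero = ⊥-elim ∘ ∉⊥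
  approx-⊆-suc (suc k) = F-mono (approx-⊆-suc k)

  Stable : ℕ → Set
  Stable k = approx (suc k) ≡ approx k

  stable-or-grows : ∀ k → Stable k ⊎ ∣ approx k ∣ < ∣ approx (suc k) ∣
  stable-or-grows k with approx k ⊂? approx (suc k)
  ... | yes p⊂q = inj₂ (p⊂q⇒∣p∣<∣q∣ p⊂q)
  ... | no p⊄q = inj₁ (⊆-antisym shrinks (approx-⊆-suc k))
    where
    shrinks : approx (suc k) ⊆ approx k
    shrinks {x} x∈q with x ∈? approx k
    ... | yes x∈p = x∈p
    ... | no x∉p = contradiction ((λ {y} → approx-⊆-suc k {y}) , x , x∈q , x∉p) p⊄q

  stable-or-large : ∀ k → Stable k ⊎ k ≤ ∣ approx k ∣
  stable-or-large zero = inj₂ z≤n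
  stable-or-large (suc k) with stable-or-large k | stable-or-grows k
  ... | inj₁ stable | _ = inj₁ (cong F stable)
  ... | inj₂ _ | inj₁ stable = inj₁ (cong F stable)
  ... | inj₂ k≤∣p∣ | inj₂ ∣p∣<∣q∣ = inj₂ (≤-<-trans k≤∣p∣ ∣p∣<∣q∣)

  μ : Subset m
  μ = approx (suc m)

  μ-fixed : F μ ≡ μ
  μ-fixed with stable-or-large (suc m)
  ... | inj₁ stable = stable
  ... | inj₂ large = contradiction (≤-trans large (∣p∣≤n μ)) 1+n≰n

  μ-prefixed : F μ ⊆ μ
  μ-prefixed = subst (_ ∈_) μ-fixed

  μ-induction : {S : Pred (Fin m) 0ℓ} → (∀ {p} → (∀ {x} → x ∈ p → S x) → ∀ {x} → x ∈ F p → S x) →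
                ∀ {x} → x ∈ μ → S x
  μ-induction {S} F-closed = below (suc m)
    where
    below : ∀ k {x} → x ∈ approx k → S x
    below zero = ⊥-elim ∘ ∉⊥
    below (suc k) = F-closed (below k)

module ModelChecking (K : Kripke) {A B : Pred (State K) 0ℓ} (A? : Decidable A) (B? : Decidable B) where

  EU-step? : ∀ W → Decidable λ s → B s ⊎ (A s × EXₚ K (_∈ W) s)
  EU-step? W s = B? s ⊎-dec (A? s ×-dec EX? K (_∈? W) s)

  AU-step? : ∀ W → Decidable λ s → B s ⊎ (A s × AXₚ K (_∈ W) s)
  AU-step? W s = B? s ⊎-dec (A? s ×-dec AX? K (_∈? W) s)

  EU-step AU-step : Subset (n K) → Subset (n K)
  EU-step W = toSubset (EU-step? W)
  AU-step W = toSubset (AU-step? W)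

  EU-step⁻ : ∀ {W x} → x ∈ EU-step W → B x ⊎ (A x × EXₚ K (_∈ W) x)
  EU-step⁻ {W} = to (∈-toSubset (EU-step? W))

  EU-step⁺ : ∀ {W x} → B x ⊎ (A x × EXₚ K (_∈ W) x) → x ∈ EU-step W
  EU-step⁺ {W} = from (∈-toSubset (EU-step? W))

  AU-step⁻ : ∀ {W x} → x ∈ AU-step W → B x ⊎ (A x × AXₚ K (_∈ W) x)
  AU-step⁻ {W} = to (∈-toSubset (AU-step? W))

  AU-step⁺ : ∀ {W x} → B x ⊎ (A x × AXₚ K (_∈ W) x) → x ∈ AU-step W
  AU-step⁺ {W} = from (∈-toSubset (AU-step? W))

  EU-mono : ∀ {p q} → p ⊆ q → EU-step p ⊆ EU-step q
  EU-mono p⊆q x∈ with EU-step⁻ x∈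
  ... | inj₁ b = EU-step⁺ (inj₁ b)
  ... | inj₂ (a , t , e , t∈p) = EU-step⁺ (inj₂ (a , t , e , p⊆q t∈p))

  AU-mono : ∀ {p q} → p ⊆ q → AU-step p ⊆ AU-step q
  AU-mono p⊆q x∈ with AU-step⁻ x∈
  ... | inj₁ b = AU-step⁺ (inj₁ b)
  ... | inj₂ (a , succ∈p) = AU-step⁺ (inj₂ (a , λ t e → p⊆q (succ∈p t e)))

  module EU-fix = LeastFixedPoint EU-step EU-mono
  module AU-fix = LeastFixedPoint AU-step AU-mono

  EU-sound : ∀ {s} → s ∈ EU-fix.μ → EUₚ K A B s
  EU-sound = EU-fix.μ-induction closed
    where
    closed : ∀ {p} → (∀ {x} → x ∈ p → EUₚ K A B x) → ∀ {x} → x ∈ EU-step p → EUₚ K A B x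
    closed IH {x} x∈ with EU-step⁻ x∈
    ... | inj₁ b = somePath K x , 0 , b , λ _ ()
    ... | inj₂ (a , t , e , t∈p) with IH t∈p
    ...   | π , k , bk , ak = _◅ₚ_ K e π , suc k , bk , λ { zero _ → a ; (suc j) (s≤s j<k) → ak j j<k }

  EU-complete : ∀ {s} → EUₚ K A B s → s ∈ EU-fix.μ
  EU-complete (π , k , bk , ak) = witness-∈μ π k bk ak
    where
    witness-∈μ : ∀ {s} (π : Path K s) k → B (proj₁ π k) → (∀ j → j < k → A (proj₁ π j)) → s ∈ EU-fix.μ
    witness-∈μ (π , refl , edges) zero b _ = EU-fix.μ-prefixed (EU-step⁺ (inj₁ b))
    witness-∈μ (π , refl , edges) (suc k) bk ak =
      EU-fix.μ-prefixed (EU-step⁺ (inj₂ (ak 0 (s≤s z≤n) , π 1 , edges 0 , witness-∈μ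
        (tailₚ K (π , refl , edges)) k bk λ j j<k → ak (suc j) (s≤s j<k))))

  AU-sound : ∀ {s} → s ∈ AU-fix.μ → AUₚ K A B s
  AU-sound = AU-fix.μ-induction closed
    where
    closed : ∀ {p} → (∀ {x} → x ∈ p → AUₚ K A B x) → ∀ {x} → x ∈ AU-step p → AUₚ K A B x
    closed IH x∈ (π , refl , edges) with AU-step⁻ x∈
    ... | inj₁ b = 0 , b , λ _ ()
    ... | inj₂ (a , succ∈p) with IH (succ∈p (π 1) (edges 0)) (tailₚ K (π , refl , edges))
    ...   | k , bk , ak = suc k , bk , λ { zero _ → a ; (suc j) (s≤s j<k) → ak j j<k }

  -- Outside the fixed point, an A-state has a successor outside it; following such successors
  -- yields a path along which B never comes.
  escape : ∀ t → ∃[ u ] (Edge K t u × (t ∉ AU-fix.μ → A t → u ∉ AU-fix.μ))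
  escape t with any? (λ u → (R K t u Bool.≟ true) ×-dec ¬? (u ∈? AU-fix.μ))
  ... | yes (u , e , u∉) = u , e , λ _ _ → u∉
  ... | no ∄ =
    proj₁ (total K t) , proj₂ (total K t) , λ t∉ a → contradiction (AU-fix.μ-prefixed (t∈step a)) t∉
    where
    t∈step : A t → t ∈ AU-step AU-fix.μ
    t∈step a = AU-step⁺ (inj₂ (a , λ u e → decidable-stable (u ∈? AU-fix.μ) (λ u∉ → ∄ (u , e , u∉))))

  AU-complete : ∀ {s} → s ∉ AU-fix.μ → ¬ AUₚ K A B s
  AU-complete {s} s∉ au with au (iteratePath K (proj₁ ∘ escape) (proj₁ ∘ proj₂ ∘ escape) s)
  ... | k , bk , ak = contradiction (AU-fix.μ-prefixed (AU-step⁺ (inj₁ bk))) (outside k ≤-refl)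
    where
    π : ℕ → State K
    π = fold s (proj₁ ∘ escape)
    outside : ∀ j → j ≤ k → π j ∉ AU-fix.μ
    outside zero _ = s∉
    outside (suc j) j<k = proj₂ (proj₂ (escape (π j))) (outside j (<⇒≤ j<k)) (ak j j<k)

  EU? : Decidable (EUₚ K A B)
  EU? s = map′ EU-sound EU-complete (s ∈? EU-fix.μ)

  AU? : Decidable (AUₚ K A B)
  AU? s with s ∈? AU-fix.μ
  ... | yes s∈ = yes (AU-sound s∈)
  ... | no s∉ = no (AU-complete s∉)

sat? : (K : Kripke) {φ : Form} → IsCTL φ → Decidable λ s → K , s ⊨ φ
sat? K (atom q) s = lab K q s Bool.≟ true
sat? K (neg c) s = ¬? (sat? K c s)
sat? K (or c d) s = sat? K c s ⊎-dec sat? K d s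
sat? K (EX c) = EX? K (sat? K c)
sat? K (EU c d) = ModelChecking.EU? K (sat? K c) (sat? K d)
sat? K (AU c d) = ModelChecking.AU? K (sat? K c) (sat? K d)

module _ (K : Kripke) (s : State K) where

  ImpliesFrom AgreeFrom : Pred (State K) 0ℓ → Pred (State K) 0ℓ → Set
  ImpliesFrom A A′ = ∀ {t} → Reach K s t → A t → A′ t
  AgreeFrom A A′ = ∀ {t} → Reach K s t → A t ⇔ A′ t

  agree-to : ∀ {A A′} → AgreeFrom A A′ → ImpliesFrom A A′
  agree-to A≐ r = to (A≐ r)

  agree-from : ∀ {A A′} → AgreeFrom A A′ → ImpliesFrom A′ A
  agree-from A≐ r = from (A≐ r)

  EX-monoFrom : ∀ {A A′} → ImpliesFrom A A′ → ImpliesFrom (EXₚ K A) (EXₚ K A′)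
  EX-monoFrom A⇒ r (u , e , a) = u , e , A⇒ (r ◅◅ (e ◅ ε)) a

  module _ {A A′ B B′ : Pred (State K) 0ℓ} (A⇒ : ImpliesFrom A A′) (B⇒ : ImpliesFrom B B′) where

    Until-monoFrom : ∀ {t} (π : Path K t) → Reach K s t → Until A B (proj₁ π) → Until A′ B′ (proj₁ π)
    Until-monoFrom π r (k , bk , ak) =
      k , B⇒ (r ◅◅ path⇒reach K π k) bk , λ j j<k → A⇒ (r ◅◅ path⇒reach K π j) (ak j j<k)

    EU-monoFrom : ImpliesFrom (EUₚ K A B) (EUₚ K A′ B′)
    EU-monoFrom r (π , until) = π , Until-monoFrom π r until

    AU-monoFrom : ImpliesFrom (AUₚ K A B) (AUₚ K A′ B′)
    AU-monoFrom r au π = Until-monoFrom π r (au π)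

  EX-respFrom : ∀ {A A′} → AgreeFrom A A′ → AgreeFrom (EXₚ K A) (EXₚ K A′)
  EX-respFrom A≐ r = mk⇔ (EX-monoFrom (agree-to A≐) r) (EX-monoFrom (agree-from A≐) r)

  EU-respFrom : ∀ {A A′ B B′} → AgreeFrom A A′ → AgreeFrom B B′ → AgreeFrom (EUₚ K A B) (EUₚ K A′ B′)
  EU-respFrom A≐ B≐ r =
    mk⇔ (EU-monoFrom (agree-to A≐) (agree-to B≐) r) (EU-monoFrom (agree-from A≐) (agree-from B≐) r)

  AU-respFrom : ∀ {A A′ B B′} → AgreeFrom A A′ → AgreeFrom B B′ → AgreeFrom (AUₚ K A B) (AUₚ K A′ B′)
  AU-respFrom A≐ B≐ r =
    mk⇔ (AU-monoFrom (agree-to A≐) (agree-to B≐) r) (AU-monoFrom (agree-from A≐) (agree-from B≐) r)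

module _ {A B : Set} (A? : Dec A) where

  ⇒′-classical : (¬ A ⊎ B) ⇔ (A → B)
  ⇒′-classical = mk⇔ (λ h a → [ contradiction a , (λ b → b) ]′ h)
                     (λ f → [ inj₂ ∘ f , inj₁ ]′ (toSum A?))

  module _ (B? : Dec B) where

    ∧′-classical : (¬ (¬ A ⊎ ¬ B)) ⇔ (A × B)
    ∧′-classical = mk⇔ (λ h → decidable-stable A? (h ∘ inj₁) , decidable-stable B? (h ∘ inj₂))
                       (λ (a , b) → [ (λ ¬a → ¬a a) , (λ ¬b → ¬b b) ]′)

⇔′-classical : ∀ {A B : Set} → Dec A → Dec B → (¬ (¬ (¬ A ⊎ B) ⊎ ¬ (¬ B ⊎ A))) ⇔ (A ⇔ B)
⇔′-classical {A} {B} A? B? = mk⇔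
  (λ h → let (A⇒B , B⇒A) = to conj h in mk⇔ (to (⇒′-classical A?) A⇒B) (to (⇒′-classical B?) B⇒A))
  (λ A⇔B → from conj (from (⇒′-classical A?) (to A⇔B) , from (⇒′-classical B?) (from A⇔B)))
  where
  conj : (¬ (¬ (¬ A ⊎ B) ⊎ ¬ (¬ B ⊎ A))) ⇔ ((¬ A ⊎ B) × (¬ B ⊎ A))
  conj = ∧′-classical (¬? A? ⊎-dec B?) (¬? B? ⊎-dec A?)

⊥′ : Form
⊥′ = neg ⊤′

⊨⊤′ : ∀ K s → K , s ⊨ ⊤′
⊨⊤′ K s with lab K 0 s Bool.≟ true
... | yes p = inj₁ p
... | no ¬p = inj₂ ¬p

⊨AG : ∀ {K s X} → IsCTL X → (K , s ⊨ AG X) ⇔ (∀ {t} → Reach K s t → K , t ⊨ X)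
⊨AG {K} {s} {X} ctl = mk⇔ everywhere (λ all (π , k , ¬x , _) → ¬x (all (path⇒reach K π k)))
  where
  everywhere : K , s ⊨ AG X → ∀ {t} → Reach K s t → K , t ⊨ X
  everywhere ¬reach {t} r with reach⇒path K r
  ... | π , k , πk≡t = decidable-stable (sat? K ctl t) λ ¬x →
    ¬reach (π , k , subst (λ u → ¬ (K , u ⊨ X)) (sym πk≡t) ¬x , λ _ _ → ⊨⊤′ K _)

⊨EU⊥′ : ∀ {K s α} → (K , s ⊨ EU ⊥′ α) ⇔ (K , s ⊨ α)
⊨EU⊥′ {K} {s} = mk⇔ now (λ a → somePath K s , 0 , a , λ _ ())
  where
  now : ∀ {α} → K , s ⊨ EU ⊥′ α → K , s ⊨ α
  now ((π , refl , _) , zero , a , _) = a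
  now (_ , suc k , _ , ⊥′-before) = contradiction (⊨⊤′ K _) (⊥′-before 0 (s≤s z≤n))

withLabels : (K : Kripke) → (Prop → State K → Bool) → Kripke
withLabels K L = record K { lab = L }

relabel-≡ : ∀ K p f t → lab (relabel K p f) p t ≡ f t
relabel-≡ K p f t with p ≟ p
... | yes _ = refl
... | no p≢p = contradiction refl p≢p

relabel-≢ : ∀ K {p q} f t → q ≢ p → lab (relabel K p f) q t ≡ lab K q t
relabel-≢ K {p} {q} f t q≢p with q ≟ p
... | yes q≡p = contradiction q≡p q≢p
... | no _ = refl

Valuation : List (Prop × Form) → ℕ → Set
Valuation ks m = All (λ _ → Fin m → Bool) ks

IsKey : Prop → List (Prop × Form) → Set
IsKey q = Any ((q ≡_) ∘ proj₁)

relabelAll : (K : Kripke) (ks : List (Prop × Form)) → Valuation ks (n K) → Prop → State K → Bool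
relabelAll K [] _ = lab K
relabelAll K ((κ , _) ∷ ks) (f ∷ F) = relabelAll (relabel K κ f) ks F

relabelAll-∉ : ∀ K ks F {q} → ¬ IsKey q ks → ∀ t → relabelAll K ks F q t ≡ lab K q t
relabelAll-∉ K [] _ _ t = refl
relabelAll-∉ K ((κ , _) ∷ ks) (f ∷ F) q∉ t =
  trans (relabelAll-∉ (relabel K κ f) ks F (q∉ ∘ there) t) (relabel-≢ K f t (q∉ ∘ here))

valuationBy : ∀ {m} → (Prop → Fin m → Bool) → ∀ ks → Valuation ks m
valuationBy T [] = []
valuationBy T ((κ , _) ∷ ks) = T κ ∷ valuationBy T ks

relabelAll-valuationBy : ∀ K T ks {q} → IsKey q ks → ∀ t → relabelAll K ks (valuationBy T ks) q t ≡ T q t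
relabelAll-valuationBy K T ((κ , _) ∷ ks) {q} q∈ t with Any.any? ((q ≟_) ∘ proj₁) ks
... | yes q∈ks = relabelAll-valuationBy (relabel K κ (T κ)) T ks q∈ks t
... | no q∉ks with q∈
...   | there q∈ks = contradiction q∈ks q∉ks
...   | here refl = trans (relabelAll-∉ (relabel K q (T q)) ks _ q∉ks t) (relabel-≡ K q (T q) t)

⊨quantify : ∀ ks φ K s → (K , s ⊨ quantify ks φ) ⇔ (∃[ F ] (withLabels K (relabelAll K ks F) , s ⊨ φ))
⊨quantify [] φ K s = mk⇔ ([] ,_) proj₂
⊨quantify ((κ , _) ∷ ks) φ K s = mk⇔
  (λ (f , h) → let (F , h′) = to (⊨quantify ks φ (relabel K κ f) s) h in f ∷ F , h′)
  (λ { (f ∷ F , h) → f , from (⊨quantify ks φ (relabel K κ f) s) (F , h) })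

⊤′-propositional : IsPropositional ⊤′
⊤′-propositional = or (atom 0) (neg (atom 0))

propositional-CTL : ∀ {φ} → IsPropositional φ → IsCTL φ
propositional-CTL (atom q) = atom q
propositional-CTL (neg p) = neg (propositional-CTL p)
propositional-CTL (or p p′) = or (propositional-CTL p) (propositional-CTL p′)

basic-CTL : ∀ {φ} → IsBasic φ → IsCTL φ
basic-CTL (EX p) = EX (propositional-CTL p)
basic-CTL (EU p p′) = EU (propositional-CTL p) (propositional-CTL p′)
basic-CTL (AU p p′) = AU (propositional-CTL p) (propositional-CTL p′)

∧′-CTL : ∀ {φ χ} → IsCTL φ → IsCTL χ → IsCTL (φ ∧′ χ)
∧′-CTL c d = neg (or (neg c) (neg d))

⇔′-CTL : ∀ {φ χ} → IsCTL φ → IsCTL χ → IsCTL (φ ⇔′ χ)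
⇔′-CTL c d = ∧′-CTL (or (neg c) d) (or (neg d) c)

AG-CTL : ∀ {φ} → IsCTL φ → IsCTL (AG φ)
AG-CTL c = neg (EU (propositional-CTL ⊤′-propositional) (neg c))

conjDefs-CTL : ∀ {Φ₀} ks → IsCTL Φ₀ → All (IsCTL ∘ proj₂) ks → IsCTL (conjDefs Φ₀ ks)
conjDefs-CTL [] c₀ [] = c₀
conjDefs-CTL ((κ , _) ∷ ks) c₀ (c ∷ cs) = ∧′-CTL (conjDefs-CTL ks c₀ cs) (AG-CTL (⇔′-CTL (atom κ) c))

Defines : (K : Kripke) → State K → Prop × Form → Set
Defines K s (κ , θ) = ∀ {t} → Reach K s t → (K , t ⊨ atom κ) ⇔ (K , t ⊨ θ)

⊨conjDefs : ∀ K s {Φ₀} ks → IsCTL Φ₀ → All (IsCTL ∘ proj₂) ks →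
            (K , s ⊨ conjDefs Φ₀ ks) ⇔ (K , s ⊨ Φ₀ × All (Defines K s) ks)
⊨conjDefs K s [] c₀ [] = mk⇔ (_, []) proj₁
⊨conjDefs K s {Φ₀} ((κ , θ) ∷ ks) c₀ (c ∷ cs) = mk⇔
  (λ h → let (rest , ag) = to conj h
             (h₀ , ds) = to IH rest
         in h₀ , (λ {t} r → to (defines t) (to (⊨AG def-CTL) ag r)) ∷ ds)
  (λ { (h₀ , d ∷ ds) → from conj (from IH (h₀ , ds) , from (⊨AG def-CTL) λ {t} r → from (defines t) (d r)) })
  where
  IH : (K , s ⊨ conjDefs Φ₀ ks) ⇔ (K , s ⊨ Φ₀ × All (Defines K s) ks)
  IH = ⊨conjDefs K s ks c₀ cs
  def-CTL : IsCTL (atom κ ⇔′ θ)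
  def-CTL = ⇔′-CTL (atom κ) c
  conj : (K , s ⊨ conjDefs Φ₀ ((κ , θ) ∷ ks)) ⇔ (K , s ⊨ conjDefs Φ₀ ks × K , s ⊨ AG (atom κ ⇔′ θ))
  conj = ∧′-classical (sat? K (conjDefs-CTL ks c₀ cs) s) (sat? K (AG-CTL def-CTL) s)
  defines : ∀ t → (K , t ⊨ (atom κ ⇔′ θ)) ⇔ ((K , t ⊨ atom κ) ⇔ (K , t ⊨ θ))
  defines t = ⇔′-classical (sat? K (atom κ) t) (sat? K c t)

⊨normalForm : ∀ K s {Φ₀} ks → IsCTL Φ₀ → All (IsCTL ∘ proj₂) ks →
              (K , s ⊨ normalForm Φ₀ ks) ⇔
              (∃[ F ] (let K′ = withLabels K (relabelAll K ks F) in K′ , s ⊨ Φ₀ × All (Defines K′ s) ks))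
⊨normalForm K s {Φ₀} ks c₀ cs = mk⇔
  (λ h → let (F , h′) = to (⊨quantify ks _ K s) h in F , to (body F) h′)
  (λ (F , h′) → from (⊨quantify ks _ K s) (F , from (body F) h′))
  where
  body : ∀ F → let K′ = withLabels K (relabelAll K ks F) in
                (K′ , s ⊨ conjDefs Φ₀ ks) ⇔ (K′ , s ⊨ Φ₀ × All (Defines K′ s) ks)
  body F = ⊨conjDefs (withLabels K (relabelAll K ks F)) s ks c₀ cs

-- The translation

record Abbrev : Set where
  constructor abbrev
  field
    κ : Prop
    θ : Form
    ψ : Form
    ψ-CTL : IsCTL ψ
open Abbrev

definition : Abbrev → Prop × Form
definition a = κ a , θ a

nextFresh : ∀ {φ} → IsCTL φ → ℕ → ℕ
nextFresh (atom _) k = k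
nextFresh (neg c) k = nextFresh c k
nextFresh (or c d) k = nextFresh d (nextFresh c k)
nextFresh (EX c) k = suc (nextFresh c k)
nextFresh (EU c d) k = suc (nextFresh d (nextFresh c k))
nextFresh (AU c d) k = suc (nextFresh d (nextFresh c k))

skeleton : ∀ {φ} → IsCTL φ → ℕ → Form
skeleton (atom q) k = atom q
skeleton (neg c) k = neg (skeleton c k)
skeleton (or c d) k = skeleton c k ∨′ skeleton d (nextFresh c k)
skeleton (EX c) k = atom (nextFresh c k)
skeleton (EU c d) k = atom (nextFresh d (nextFresh c k))
skeleton (AU c d) k = atom (nextFresh d (nextFresh c k))

abbrevs : ∀ {φ} → IsCTL φ → ℕ → List Abbrev
abbrevs (atom _) k = []
abbrevs (neg c) k = abbrevs c k
abbrevs (or c d) k = abbrevs c k ++ abbrevs d (nextFresh c k)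
abbrevs (EX {φ} c) k = abbrevs c k ∷ʳ abbrev (nextFresh c k) (EX (skeleton c k)) (EX φ) (EX c)
abbrevs (EU {φ} {χ} c d) k = (abbrevs c k ++ abbrevs d k′) ∷ʳ
  abbrev (nextFresh d k′) (EU (skeleton c k) (skeleton d k′)) (EU φ χ) (EU c d)
  where
  k′ : ℕ
  k′ = nextFresh c k
abbrevs (AU {φ} {χ} c d) k = (abbrevs c k ++ abbrevs d k′) ∷ʳ
  abbrev (nextFresh d k′) (AU (skeleton c k) (skeleton d k′)) (AU φ χ) (AU c d)
  where
  k′ : ℕ
  k′ = nextFresh c k

atoms : Form → List Prop
atoms (atom q) = [ q ]
atoms (neg φ) = atoms φ
atoms (φ ∨′ χ) = atoms φ ++ atoms χ
atoms (EX φ) = atoms φ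
atoms (EU φ χ) = atoms φ ++ atoms χ
atoms (AU φ χ) = atoms φ ++ atoms χ
atoms (∃p p φ) = p ∷ atoms φ

skeleton-propositional : ∀ {φ} (c : IsCTL φ) k → IsPropositional (skeleton c k)
skeleton-propositional (atom q) k = atom q
skeleton-propositional (neg c) k = neg (skeleton-propositional c k)
skeleton-propositional (or c d) k = or (skeleton-propositional c k) (skeleton-propositional d _)
skeleton-propositional (EX c) k = atom _
skeleton-propositional (EU c d) k = atom _
skeleton-propositional (AU c d) k = atom _

abbrevs-basic : ∀ {φ} (c : IsCTL φ) k → All (IsBasic ∘ θ) (abbrevs c k)
abbrevs-basic (atom _) k = []
abbrevs-basic (neg c) k = abbrevs-basic c k
abbrevs-basic (or c d) k = ++⁺ (abbrevs-basic c k) (abbrevs-basic d _)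
abbrevs-basic (EX c) k = ∷ʳ⁺ (abbrevs-basic c k) (EX (skeleton-propositional c k))
abbrevs-basic (EU c d) k = ∷ʳ⁺ (++⁺ (abbrevs-basic c k) (abbrevs-basic d _))
  (EU (skeleton-propositional c k) (skeleton-propositional d _))
abbrevs-basic (AU c d) k = ∷ʳ⁺ (++⁺ (abbrevs-basic c k) (abbrevs-basic d _))
  (AU (skeleton-propositional c k) (skeleton-propositional d _))

nextFresh-≥ : ∀ {φ} (c : IsCTL φ) k → k ≤ nextFresh c k
nextFresh-≥ (atom _) k = ≤-refl
nextFresh-≥ (neg c) k = nextFresh-≥ c k
nextFresh-≥ (or c d) k = ≤-trans (nextFresh-≥ c k) (nextFresh-≥ d _)
nextFresh-≥ (EX c) k = m≤n⇒m≤1+n (nextFresh-≥ c k)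
nextFresh-≥ (EU c d) k = m≤n⇒m≤1+n (≤-trans (nextFresh-≥ c k) (nextFresh-≥ d _))
nextFresh-≥ (AU c d) k = m≤n⇒m≤1+n (≤-trans (nextFresh-≥ c k) (nextFresh-≥ d _))

abbrevs-≥ : ∀ {φ} (c : IsCTL φ) k → All ((k ≤_) ∘ κ) (abbrevs c k)
abbrevs₂-≥ : ∀ {φ χ} (c : IsCTL φ) (d : IsCTL χ) k → All ((k ≤_) ∘ κ) (abbrevs (or c d) k)

abbrevs-≥ (atom _) k = []
abbrevs-≥ (neg c) k = abbrevs-≥ c k
abbrevs-≥ (or c d) k = abbrevs₂-≥ c d k
abbrevs-≥ (EX c) k = ∷ʳ⁺ (abbrevs-≥ c k) (nextFresh-≥ c k)
abbrevs-≥ (EU c d) k = ∷ʳ⁺ (abbrevs₂-≥ c d k) (nextFresh-≥ (or c d) k)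
abbrevs-≥ (AU c d) k = ∷ʳ⁺ (abbrevs₂-≥ c d k) (nextFresh-≥ (or c d) k)
abbrevs₂-≥ c d k = ++⁺ (abbrevs-≥ c k) (All.map (≤-trans (nextFresh-≥ c k)) (abbrevs-≥ d _))

abbrevs-< : ∀ {φ} (c : IsCTL φ) k → All ((_< nextFresh c k) ∘ κ) (abbrevs c k)
abbrevs₂-< : ∀ {φ χ} (c : IsCTL φ) (d : IsCTL χ) k → All ((_< nextFresh (or c d) k) ∘ κ) (abbrevs (or c d) k)

abbrevs-< (atom _) k = []
abbrevs-< (neg c) k = abbrevs-< c k
abbrevs-< (or c d) k = abbrevs₂-< c d k
abbrevs-< (EX c) k = ∷ʳ⁺ (All.map m<n⇒m<1+n (abbrevs-< c k)) (n<1+n _)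
abbrevs-< (EU c d) k = ∷ʳ⁺ (All.map m<n⇒m<1+n (abbrevs₂-< c d k)) (n<1+n _)
abbrevs-< (AU c d) k = ∷ʳ⁺ (All.map m<n⇒m<1+n (abbrevs₂-< c d k)) (n<1+n _)
abbrevs₂-< c d k = ++⁺ (All.map (λ κ< → <-≤-trans κ< (nextFresh-≥ d _)) (abbrevs-< c k)) (abbrevs-< d _)

separated : ∀ {m} {xs ys : List Abbrev} → All ((_< m) ∘ κ) xs → All ((m ≤_) ∘ κ) ys →
            All (λ x → All ((κ x <_) ∘ κ) ys) xs
separated xs<m m≤ys = All.map (λ x<m → All.map (<-≤-trans x<m) m≤ys) xs<m

abbrevs-increasing : ∀ {φ} (c : IsCTL φ) k → AllPairs (_<_ on κ) (abbrevs c k)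
abbrevs₂-increasing : ∀ {φ χ} (c : IsCTL φ) (d : IsCTL χ) k → AllPairs (_<_ on κ) (abbrevs (or c d) k)

abbrevs-increasing (atom _) k = []
abbrevs-increasing (neg c) k = abbrevs-increasing c k
abbrevs-increasing (or c d) k = abbrevs₂-increasing c d k
abbrevs-increasing (EX c) k =
  AllPairs.++⁺ (abbrevs-increasing c k) ([] ∷ []) (separated (abbrevs-< c k) (≤-refl ∷ []))
abbrevs-increasing (EU c d) k =
  AllPairs.++⁺ (abbrevs₂-increasing c d k) ([] ∷ []) (separated (abbrevs₂-< c d k) (≤-refl ∷ []))
abbrevs-increasing (AU c d) k =
  AllPairs.++⁺ (abbrevs₂-increasing c d k) ([] ∷ []) (separated (abbrevs₂-< c d k) (≤-refl ∷ []))
abbrevs₂-increasing c d k =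
  AllPairs.++⁺ (abbrevs-increasing c k) (abbrevs-increasing d _) (separated (abbrevs-< c k) (abbrevs-≥ d _))

κ-IsKey : ∀ as → All (λ a → IsKey (κ a) (map definition as)) as
κ-IsKey [] = []
κ-IsKey (a ∷ as) = here refl ∷ All.map there (κ-IsKey as)

below-¬IsKey : ∀ {b q} → q < b → ∀ {as} → All ((b ≤_) ∘ κ) as → ¬ IsKey q (map definition as)
below-¬IsKey q<b (b≤κ ∷ _) (here refl) = <⇒≱ q<b b≤κ
below-¬IsKey q<b (_ ∷ b≤κs) (there isKey) = below-¬IsKey q<b b≤κs isKey

does≡true⇔ : ∀ {A : Set} (A? : Dec A) → (does A? ≡ true) ⇔ A
does≡true⇔ (yes a) = mk⇔ (λ _ → a) (λ _ → refl)
does≡true⇔ (no ¬a) = mk⇔ (λ ()) (λ a → contradiction a ¬a)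

≡true⇔≡true : ∀ {x y} → x ≡ y → (x ≡ true) ⇔ (y ≡ true)
≡true⇔≡true x≡y = mk⇔ (trans (sym x≡y)) (trans x≡y)

meaningLabel : (K : Kripke) → List Abbrev → Prop → State K → Bool
meaningLabel K [] q t = false
meaningLabel K (a ∷ as) q t with q ≟ κ a
... | yes _ = does (sat? K (ψ-CTL a) t)
... | no _ = meaningLabel K as q t

meaningLabel-κ : ∀ K {as} → AllPairs (_<_ on κ) as →
                 All (λ a → ∀ t → (meaningLabel K as (κ a) t ≡ true) ⇔ (K , t ⊨ ψ a)) as
meaningLabel-κ K [] = []
meaningLabel-κ K {a ∷ as} (a<as ∷ increasing) =
  first ∷ All.zipWith (λ {a′} → later {a′}) (a<as , meaningLabel-κ K increasing)
  where
  first : ∀ t → (meaningLabel K (a ∷ as) (κ a) t ≡ true) ⇔ (K , t ⊨ ψ a)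
  first t with κ a ≟ κ a
  ... | yes _ = does≡true⇔ (sat? K (ψ-CTL a) t)
  ... | no κ≢κ = contradiction refl κ≢κ
  later : ∀ {a′} → κ a < κ a′ × (∀ t → (meaningLabel K as (κ a′) t ≡ true) ⇔ (K , t ⊨ ψ a′)) →
          ∀ t → (meaningLabel K (a ∷ as) (κ a′) t ≡ true) ⇔ (K , t ⊨ ψ a′)
  later {a′} (a<a′ , correct) t with κ a′ ≟ κ a
  ... | yes a′≡a = contradiction (sym a′≡a) (<⇒≢ a<a′)
  ... | no _ = correct t

module Agreement (K : Kripke) (L : Prop → State K → Bool) (s : State K) where

  K′ : Kripke
  K′ = withLabels K L

  _≈_ : Form → Form → Set
  φ′ ≈ φ = AgreeFrom K s (λ t → K′ , t ⊨ φ′) (λ t → K , t ⊨ φ)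

  Faithful : Abbrev → Set
  Faithful a = θ a ≈ ψ a → atom (κ a) ≈ ψ a

  -- Both directions of the equivalence rest on this induction: forwards, every atom means its
  -- subformula by the choice of labelling; backwards, it comes to mean it through its definition
  -- κ ↔ θ as soon as θ ≈ ψ is known.
  skeleton-≈ : ∀ {φ} (c : IsCTL φ) k → All (λ q → ∀ t → L q t ≡ lab K q t) (atoms φ) →
               All Faithful (abbrevs c k) → skeleton c k ≈ φ × All (λ a → θ a ≈ ψ a) (abbrevs c k)
  skeleton-≈ (atom q) k (L≡lab ∷ []) [] = (λ {t} _ → ≡true⇔≡true (L≡lab t)) , []
  skeleton-≈ (neg c) k same faithful =
    let (≈φ , defs) = skeleton-≈ c k same faithful in (λ r → ¬-cong-⇔ (≈φ r)) , defs
  skeleton-≈ (or {φ} c d) k same faithful =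
    let (same₁ , same₂) = ++⁻ (atoms φ) same
        (faithful₁ , faithful₂) = ++⁻ (abbrevs c k) faithful
        (≈φ , defs₁) = skeleton-≈ c k same₁ faithful₁
        (≈χ , defs₂) = skeleton-≈ d _ same₂ faithful₂
    in (λ r → ≈φ r ⊎-⇔ ≈χ r) , ++⁺ defs₁ defs₂
  skeleton-≈ (EX c) k same faithful =
    let (faithful₁ , top) = ∷ʳ⁻ faithful
        (≈φ , defs) = skeleton-≈ c k same faithful₁
        θ≈ψ = EX-respFrom K s ≈φ
    in top θ≈ψ , ∷ʳ⁺ defs θ≈ψ
  skeleton-≈ (EU {φ} c d) k same faithful =
    let (same₁ , same₂) = ++⁻ (atoms φ) same
        (faithful₁₂ , top) = ∷ʳ⁻ faithful
        (faithful₁ , faithful₂) = ++⁻ (abbrevs c k) faithful₁₂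
        (≈φ , defs₁) = skeleton-≈ c k same₁ faithful₁
        (≈χ , defs₂) = skeleton-≈ d _ same₂ faithful₂
        θ≈ψ = EU-respFrom K s ≈φ ≈χ
    in top θ≈ψ , ∷ʳ⁺ (++⁺ defs₁ defs₂) θ≈ψ
  skeleton-≈ (AU {φ} c d) k same faithful =
    let (same₁ , same₂) = ++⁻ (atoms φ) same
        (faithful₁₂ , top) = ∷ʳ⁻ faithful
        (faithful₁ , faithful₂) = ++⁻ (abbrevs c k) faithful₁₂
        (≈φ , defs₁) = skeleton-≈ c k same₁ faithful₁
        (≈χ , defs₂) = skeleton-≈ d _ same₂ faithful₂
        θ≈ψ = AU-respFrom K s ≈φ ≈χ
    in top θ≈ψ , ∷ʳ⁺ (++⁺ defs₁ defs₂) θ≈ψ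

module Translation {Φ} (ctl : IsCTL Φ) where

  firstFresh : ℕ
  firstFresh = suc (max 0 (atoms Φ))

  as : List Abbrev
  as = abbrevs ctl firstFresh

  ks : List (Prop × Form)
  ks = map definition as

  -- An atom is not a basic formula, but E ⊥ U α is one and is equivalent to α.
  Φ₀ : Form
  Φ₀ = EU ⊥′ (skeleton ctl firstFresh)

  Φ₀-CTL : IsCTL Φ₀
  Φ₀-CTL = basic-CTL (EU (neg ⊤′-propositional) (skeleton-propositional ctl firstFresh))

  ks-CTL : All (IsCTL ∘ proj₂) ks
  ks-CTL = map⁺ (All.map basic-CTL (abbrevs-basic ctl firstFresh))

  atoms-unrelabelled : ∀ K F → All (λ q → ∀ t → relabelAll K ks F q t ≡ lab K q t) (atoms Φ)
  atoms-unrelabelled K F =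
    All.map (λ q<k → relabelAll-∉ K ks F (below-¬IsKey q<k (abbrevs-≥ ctl firstFresh)))
            (All.map s≤s (xs≤max 0 (atoms Φ)))

  Witness : (K : Kripke) → State K → Set
  Witness K s = ∃[ F ] (let K′ = withLabels K (relabelAll K ks F) in K′ , s ⊨ Φ₀ × All (Defines K′ s) ks)

  witness : ∀ K s → K , s ⊨ Φ → Witness K s
  witness K s h = F , from ⊨EU⊥′ (from (proj₁ agreement ε) h) , map⁺ defines
    where
    F : Valuation ks (n K)
    F = valuationBy (meaningLabel K as) ks
    open Agreement K (relabelAll K ks F) s
    means : All (λ a → atom (κ a) ≈ ψ a) as
    means = All.zipWith
      (λ (isKey , correct) {t} _ →
         ⇔-trans (≡true⇔≡true (relabelAll-valuationBy K (meaningLabel K as) ks isKey t)) (correct t))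
      (κ-IsKey as , meaningLabel-κ K (abbrevs-increasing ctl firstFresh))
    agreement : skeleton ctl firstFresh ≈ Φ × All (λ a → θ a ≈ ψ a) as
    agreement = skeleton-≈ ctl firstFresh (atoms-unrelabelled K F)
                  (All.map (λ κ≈ψ _ {t} → κ≈ψ {t}) means)
    defines : All (Defines K′ s ∘ definition) as
    defines = All.zipWith (λ (κ≈ψ , θ≈ψ) {t} r → ⇔-trans (κ≈ψ r) (⇔-sym (θ≈ψ r)))
                          (means , proj₂ agreement)

  unwitness : ∀ K s → Witness K s → K , s ⊨ Φ
  unwitness K s (F , h₀ , defines) =
    to (proj₁ (skeleton-≈ ctl firstFresh (atoms-unrelabelled K F) faithful) ε) (to ⊨EU⊥′ h₀)
    where
    open Agreement K (relabelAll K ks F) s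
    faithful : All Faithful as
    faithful = All.map (λ κ⇔θ θ≈ψ {t} r → ⇔-trans (κ⇔θ r) (θ≈ψ r)) (map⁻ defines)

  equivalence : Φ ≣ normalForm Φ₀ ks
  equivalence K s = from normal ∘ witness K s , unwitness K s ∘ to normal
    where
    normal : (K , s ⊨ normalForm Φ₀ ks) ⇔ Witness K s
    normal = ⊨normalForm K s ks Φ₀-CTL ks-CTL

-- Size

defCost : Prop × Form → ℕ
defCost (_ , θ) = 22 + 2 * size θ

size-quantify : ∀ ks φ → size (quantify ks φ) ≡ length ks + size φ
size-quantify [] φ = refl
size-quantify (_ ∷ ks) φ = cong suc (size-quantify ks φ)

size-conjDefs : ∀ Φ₀ ks → size (conjDefs Φ₀ ks) + length ks ≡ size Φ₀ + sum (map defCost ks)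
size-conjDefs Φ₀ [] = refl
size-conjDefs Φ₀ ((κ , θ) ∷ ks) = begin
  size (conjDefs Φ₀ ks ∧′ AG (atom κ ⇔′ θ)) + suc (length ks)
    ≡⟨ unfolded (size (conjDefs Φ₀ ks)) (length ks) (size θ) ⟩
  (size (conjDefs Φ₀ ks) + length ks) + defCost (κ , θ)
    ≡⟨ cong (_+ defCost (κ , θ)) (size-conjDefs Φ₀ ks) ⟩
  (size Φ₀ + sum (map defCost ks)) + defCost (κ , θ)
    ≡⟨ rearrange (size Φ₀) (sum (map defCost ks)) (defCost (κ , θ)) ⟩
  size Φ₀ + (defCost (κ , θ) + sum (map defCost ks)) ∎
  where
  open ≡-Reasoning
  -- The left-hand side is the size on the first line above, computed as far as it goes.
  unfolded : ∀ c l y →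
             3 + (c + suc (6 + suc (3 + (3 + (y + (3 + (y + 1))))))) + suc l ≡ (c + l) + (22 + 2 * y)
  unfolded = solve-∀
  rearrange : ∀ a b c → (a + b) + c ≡ a + (c + b)
  rearrange = solve-∀

size-normalForm : ∀ Φ₀ ks → size (normalForm Φ₀ ks) ≡ size Φ₀ + sum (map defCost ks)
size-normalForm Φ₀ ks = begin
  size (quantify ks (conjDefs Φ₀ ks))  ≡⟨ size-quantify ks _ ⟩
  length ks + size (conjDefs Φ₀ ks)    ≡⟨ +-comm (length ks) _ ⟩
  size (conjDefs Φ₀ ks) + length ks    ≡⟨ size-conjDefs Φ₀ ks ⟩
  size Φ₀ + sum (map defCost ks)       ∎
  where open ≡-Reasoning

abbrevCost : List Abbrev → ℕ
abbrevCost as = sum (map (defCost ∘ definition) as)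

abbrevCost-++ : ∀ xs ys → abbrevCost (xs ++ ys) ≡ abbrevCost xs + abbrevCost ys
abbrevCost-++ xs ys = trans (cong sum (map-++ _ xs ys)) (sum-++ (map _ xs) _)

translationCost : ∀ {φ} → IsCTL φ → ℕ → ℕ
translationCost c k = 2 * size (skeleton c k) + abbrevCost (abbrevs c k)

translationCost-neg : ∀ {φ} (c : IsCTL φ) k → translationCost (neg c) k ≡ 2 + translationCost c k
translationCost-neg c k = arith (size (skeleton c k)) (abbrevCost (abbrevs c k))
  where
  arith : ∀ s w → 2 * suc s + w ≡ 2 + (2 * s + w)
  arith = solve-∀

translationCost-or : ∀ {φ χ} (c : IsCTL φ) (d : IsCTL χ) k →
                     translationCost (or c d) k ≡
                     2 + (translationCost c k + translationCost d (nextFresh c k))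
translationCost-or c d k =
  trans (cong (2 * size (skeleton (or c d) k) +_) (abbrevCost-++ (abbrevs c k) _))
        (arith (size (skeleton c k)) (size (skeleton d _))
               (abbrevCost (abbrevs c k)) (abbrevCost (abbrevs d _)))
  where
  arith : ∀ s₁ s₂ w₁ w₂ → 2 * suc (s₁ + s₂) + (w₁ + w₂) ≡ 2 + ((2 * s₁ + w₁) + (2 * s₂ + w₂))
  arith = solve-∀

temporal-arith : ∀ s w → 2 + (w + (22 + 2 * suc s + 0)) ≡ 24 + (2 * suc s + w)
temporal-arith = solve-∀

translationCost-EX : ∀ {φ} (c : IsCTL φ) k → translationCost (EX c) k ≡ 24 + translationCost (neg c) k
translationCost-EX c k =
  trans (cong (2 +_) (abbrevCost-++ (abbrevs c k) _))
        (temporal-arith (size (skeleton c k)) (abbrevCost (abbrevs c k)))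

translationCost-EU : ∀ {φ χ} (c : IsCTL φ) (d : IsCTL χ) k →
                     translationCost (EU c d) k ≡ 24 + translationCost (or c d) k
translationCost-EU c d k =
  trans (cong (2 +_) (abbrevCost-++ (abbrevs (or c d) k) _))
        (temporal-arith (size (skeleton c k) + size (skeleton d _)) (abbrevCost (abbrevs (or c d) k)))

translationCost-AU : ∀ {φ χ} (c : IsCTL φ) (d : IsCTL χ) k →
                     translationCost (AU c d) k ≡ 24 + translationCost (or c d) k
translationCost-AU c d k =
  trans (cong (2 +_) (abbrevCost-++ (abbrevs (or c d) k) _))
        (temporal-arith (size (skeleton c k) + size (skeleton d _)) (abbrevCost (abbrevs (or c d) k)))

grow : ∀ a {x m} → a ≤ 26 → x ≤ 26 * m → a + x ≤ 26 * suc m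
grow a {x} {m} a≤26 x≤ = begin
  a + x         ≤⟨ +-mono-≤ a≤26 x≤ ⟩
  26 + 26 * m   ≡⟨ sym (*-suc 26 m) ⟩
  26 * suc m    ∎
  where open ≤-Reasoning

grow₂ : ∀ a {x y} m m′ → a ≤ 26 → x ≤ 26 * m → y ≤ 26 * m′ → a + (x + y) ≤ 26 * suc (m + m′)
grow₂ a m m′ a≤26 x≤ y≤ = grow a a≤26 (≤-trans (+-mono-≤ x≤ y≤) (≤-reflexive (sym (*-distribˡ-+ 26 m m′))))

translationCost-≤ : ∀ {φ} (c : IsCTL φ) k → translationCost c k ≤ 26 * size φ
translationCost-≤ (atom q) k = s≤s (s≤s z≤n)
translationCost-≤ (neg c) k =
  ≤-trans (≤-reflexive (translationCost-neg c k)) (grow 2 (s≤s (s≤s z≤n)) (translationCost-≤ c k))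
translationCost-≤ (or {φ} {χ} c d) k =
  ≤-trans (≤-reflexive (translationCost-or c d k))
          (grow₂ 2 (size φ) (size χ) (s≤s (s≤s z≤n)) (translationCost-≤ c k) (translationCost-≤ d _))
translationCost-≤ (EX c) k =
  ≤-trans (≤-reflexive (trans (translationCost-EX c k) (cong (24 +_) (translationCost-neg c k))))
          (grow 26 ≤-refl (translationCost-≤ c k))
translationCost-≤ (EU {φ} {χ} c d) k =
  ≤-trans (≤-reflexive (trans (translationCost-EU c d k) (cong (24 +_) (translationCost-or c d k))))
          (grow₂ 26 (size φ) (size χ) ≤-refl (translationCost-≤ c k) (translationCost-≤ d _))
translationCost-≤ (AU {φ} {χ} c d) k =
  ≤-trans (≤-reflexive (trans (translationCost-AU c d k) (cong (24 +_) (translationCost-or c d k))))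
          (grow₂ 26 (size φ) (size χ) ≤-refl (translationCost-≤ c k) (translationCost-≤ d _))

size-positive : ∀ φ → 1 ≤ size φ
size-positive (atom _) = s≤s z≤n
size-positive (neg _) = s≤s z≤n
size-positive (_ ∨′ _) = s≤s z≤n
size-positive (EX _) = s≤s z≤n
size-positive (EU _ _) = s≤s z≤n
size-positive (AU _ _) = s≤s z≤n
size-positive (∃p _ _) = s≤s z≤n

size-normalForm-≤ : ∀ {Φ} (c : IsCTL Φ) k →
                    size (normalForm (EU ⊥′ (skeleton c k)) (map definition (abbrevs c k))) ≤ 32 * size Φ
size-normalForm-≤ {Φ} c k = begin
  size (normalForm (EU ⊥′ (skeleton c k)) (map definition as))
    ≡⟨ size-normalForm _ (map definition as) ⟩
  6 + s + sum (map defCost (map definition as))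
    ≡⟨ cong (λ w → 6 + s + sum w) (sym (map-∘ as)) ⟩
  6 + s + abbrevCost as
    ≤⟨ +-monoʳ-≤ 6 (+-monoˡ-≤ (abbrevCost as) (m≤m+n s (s + 0))) ⟩
  6 + translationCost c k
    ≤⟨ +-monoʳ-≤ 6 (translationCost-≤ c k) ⟩
  6 + 26 * size Φ
    ≤⟨ +-monoˡ-≤ (26 * size Φ) (*-monoʳ-≤ 6 (size-positive Φ)) ⟩
  6 * size Φ + 26 * size Φ
    ≡⟨ sym (*-distribʳ-+ (size Φ) 6 26) ⟩
  32 * size Φ ∎
  where
  open ≤-Reasoning
  as : List Abbrev
  as = abbrevs c k
  s : ℕ
  s = size (skeleton c k)

proposition3 : ∃[ C ] ((Φ : Form) → IsCTL Φ →
    Σ Form λ Φ₀ → Σ (List (ℕ × Form)) λ ks →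
      IsBoolCombBasic Φ₀ × All (λ kθ → IsBasic (proj₂ kθ)) ks
      × (Φ ≣ normalForm Φ₀ ks) × (size (normalForm Φ₀ ks) ≤ C * size Φ))
proposition3 = 32 , λ Φ ctl → let open Translation ctl in
  Φ₀ , ks ,
  basic (EU (neg ⊤′-propositional) (skeleton-propositional ctl firstFresh)) ,
  map⁺ (abbrevs-basic ctl firstFresh) ,
  equivalence ,
  size-normalForm-≤ ctl firstFresh
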